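{- Let $(c_n)_{n\ge0}$ be a sequence of real numbers with $c_0=1$, and let $(f_n(y))_{n\ge0}$ be the Appell polynomials defined by $\sum_{n\ge0}f_n(y)\frac{t^n}{n!}=\Bigl(\sum_{n\ge0}c_n\frac{t^n}{n!}\Bigr)e^{yt}$. Let $(a_n)_{n\ge0}$ be a sequence of real numbers and $S_k(q)=\sum_{j=0}^{k}a_j\binom{k}{j}(1-q)^jq^{k-j}$. Then for any real $b$ and every $n\ge0$, $$\sum_{k=0}^{n}a_k\binom{n}{k}(bx)^kf_{n-k}\bigl(y+(1-b)x\bigr)=\sum_{k=0}^{n}S_k(1-b)\binom{n}{k}x^kf_{n-k}(y).$$
   Context: Equivalently $f_n(y)=\sum_{k=0}^n\binom{n}{k}c_ky^{n-k}$. -}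

module Defs where

open import Level using (Level)
open import Data.Nat using (ℕ; zero; suc; _∸_)
open import Data.Nat.Combinatorics using (_C_)
open import Algebra.Bundles using (CommutativeRing; Semiring)

-- Definitions relative to an arbitrary commutative ring R
-- (the paper works over the reals).
module Appell {c ℓ : Level} (R : CommutativeRing c ℓ) where
  open CommutativeRing R
  open import Algebra.Definitions.RawSemiring (Semiring.rawSemiring semiring) public
    using (_×_; _^_)

  sumTo : ℕ → (ℕ → Carrier) → Carrier
  sumTo zero    g = g 0
  sumTo (suc n) g = sumTo n g + g (suc n)

  appell : (ℕ → Carrier) → ℕ → Carrier → Carrier
  appell cs n y = sumTo n (λ k → (n C k) × (cs k * y ^ (n ∸ k)))

  S : (ℕ → Carrier) → ℕ → Carrier → Carrier
  S a k q = sumTo k (λ j → a j * ((k C j) × ((1# - q) ^ j * q ^ (k ∸ j))))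

-- Binomial convolution (u ⋆ v) n = Σₖ (n choose k) uₖ vₙ₋ₖ is the coefficient form of the
-- product of exponential generating functions, so it is commutative and associative, and the
-- binomial theorem says powers (y + z) = powers y ⋆ powers z.  An Appell sequence is
-- f(y) = c ⋆ powers y, hence f(y + z) = f(y) ⋆ powers z.  With w = 1 - b the left-hand side is
-- (a·powers(bx)) ⋆ f(y) ⋆ powers(wx), and regrouping as ((a·powers(bx)) ⋆ powers(wx)) ⋆ f(y)
-- exhibits the k-th factor as Sₖ(w) xᵏ.
module Submission where

open import Defs
open import Level using (Level)
open import Data.Nat using (ℕ; _∸_)
open import Data.Nat.Combinatorics using (_C_)
open import Algebra.Bundles using (CommutativeRing)
open import Data.Nat using (zero; suc; _≤_; z≤n)
import Data.Nat as ℕ using (_*_)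
import Data.Nat.Properties as ℕₚ
open import Data.Fin using (Fin; toℕ)
open import Function using (_∘_)
import Relation.Binary.PropositionalEquality as ≡

module BinomialCoefficients where
  open import Data.Nat
  open import Data.Nat.Properties
  open import Data.Nat.Combinatorics
  open import Data.Nat.Combinatorics.Specification using (nCk≡n!/k![n-k]!)
  open import Data.Nat.DivMod using (m/n*n≡m)
  open import Data.Nat.Solver using (module +-*-Solver)
  open +-*-Solver
  open import Relation.Binary.PropositionalEquality
  open ≡-Reasoning

  nCk*[k!*[n∸k]!]≡n! : ∀ {n k} → k ≤ n → (n C k) * (k ! * (n ∸ k) !) ≡ n !
  nCk*[k!*[n∸k]!]≡n! {n} {k} k≤n = begin
    (n C k) * (k ! * (n ∸ k) !)
      ≡⟨ cong (_* (k ! * (n ∸ k) !)) (nCk≡n!/k![n-k]! k≤n) ⟩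
    (n ! / (k ! * (n ∸ k) !)) {{k !* (n ∸ k) !≢0}} * (k ! * (n ∸ k) !)
      ≡⟨ m/n*n≡m {{k !* (n ∸ k) !≢0}} (k![n∸k]!∣n! k≤n) ⟩
    n ! ∎

  n∸j∸[k∸j]≡n∸k : ∀ n {j k} → j ≤ k → n ∸ j ∸ (k ∸ j) ≡ n ∸ k
  n∸j∸[k∸j]≡n∸k n {j} {k} j≤k =
    trans (∸-+-assoc n j (k ∸ j)) (cong (n ∸_) (m+[n∸m]≡n j≤k))

  nCj*[n∸j]C[k∸j]≡nCk*kCj : ∀ {n j k} → j ≤ k → k ≤ n →
                            (n C j) * ((n ∸ j) C (k ∸ j)) ≡ (n C k) * (k C j)
  nCj*[n∸j]C[k∸j]≡nCk*kCj {n} {j} {k} j≤k k≤n =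
    *-cancelʳ-≡ _ _ (j ! * (k ∸ j) ! * (n ∸ k) !) {{factorials≢0}} (begin
      (n C j) * ((n ∸ j) C (k ∸ j)) * (j ! * (k ∸ j) ! * (n ∸ k) !)
        ≡⟨ solve 5 (λ a b x y z → a :* b :* (x :* y :* z) := a :* (x :* (b :* (y :* z))))
                 refl (n C j) ((n ∸ j) C (k ∸ j)) (j !) ((k ∸ j) !) ((n ∸ k) !) ⟩
      (n C j) * (j ! * (((n ∸ j) C (k ∸ j)) * ((k ∸ j) ! * (n ∸ k) !)))
        ≡⟨ cong (λ r → (n C j) * (j ! * r)) inner ⟩
      (n C j) * (j ! * (n ∸ j) !)
        ≡⟨ nCk*[k!*[n∸k]!]≡n! (≤-trans j≤k k≤n) ⟩
      n !
        ≡⟨ nCk*[k!*[n∸k]!]≡n! k≤n ⟨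
      (n C k) * (k ! * (n ∸ k) !)
        ≡⟨ cong (λ r → (n C k) * (r * (n ∸ k) !)) (nCk*[k!*[n∸k]!]≡n! j≤k) ⟨
      (n C k) * ((k C j) * (j ! * (k ∸ j) !) * (n ∸ k) !)
        ≡⟨ solve 5 (λ a b x y z → a :* (b :* (x :* y) :* z) := a :* b :* (x :* y :* z))
                 refl (n C k) (k C j) (j !) ((k ∸ j) !) ((n ∸ k) !) ⟩
      (n C k) * (k C j) * (j ! * (k ∸ j) ! * (n ∸ k) !) ∎)
    where
    factorials≢0 : NonZero (j ! * (k ∸ j) ! * (n ∸ k) !)
    factorials≢0 =
      m*n≢0 (j ! * (k ∸ j) !) ((n ∸ k) !) {{j !* (k ∸ j) !≢0}} {{(n ∸ k) !≢0}}
    inner : ((n ∸ j) C (k ∸ j)) * ((k ∸ j) ! * (n ∸ k) !) ≡ (n ∸ j) !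
    inner = begin
      ((n ∸ j) C (k ∸ j)) * ((k ∸ j) ! * (n ∸ k) !)
        ≡⟨ cong (λ r → ((n ∸ j) C (k ∸ j)) * ((k ∸ j) ! * r !))
                (n∸j∸[k∸j]≡n∸k n j≤k) ⟨
      ((n ∸ j) C (k ∸ j)) * ((k ∸ j) ! * (n ∸ j ∸ (k ∸ j)) !)
        ≡⟨ nCk*[k!*[n∸k]!]≡n! (∸-monoˡ-≤ j k≤n) ⟩
      (n ∸ j) ! ∎

module BinomialConvolution {c ℓ : Level} (R : CommutativeRing c ℓ) where
  open CommutativeRing R
  open Appell R
  open import Relation.Binary.Reasoning.Setoid setoid
  open import Algebra.Properties.Semiring.Mult semiring
    using (×-comm-*; ×-assoc-*; ×-assocˡ; ×-cong; ×-congʳ)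
  open import Algebra.Properties.CommutativeMonoid.Mult +-commutativeMonoid using (×-distrib-+)
  open import Algebra.Properties.CommutativeSemigroup +-commutativeSemigroup using (interchange)
  open import Algebra.Properties.Semiring.Exp semiring using (^-congʳ; ^-homo-*)
  open import Algebra.Properties.CommutativeSemiring.Exp commutativeSemiring using (^-distrib-*)
  open import Algebra.Properties.AbelianGroup +-abelianGroup using (⁻¹-anti-homo‿-; xyx⁻¹≈y)
  import Algebra.Properties.CommutativeSemiring.Binomial commutativeSemiring as Binomial
  open import Algebra.Definitions.RawMonoid +-rawMonoid using (sum)
  open import Algebra.Solver.Ring.NaturalCoefficients.Default commutativeSemiring
  open import Data.Nat.Combinatorics using (nCk≡nC[n∸k])
  open BinomialCoefficients using (n∸j∸[k∸j]≡n∸k; nCj*[n∸j]C[k∸j]≡nCk*kCj)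

  x-[x-y]≈y : ∀ x y → x - (x - y) ≈ y
  x-[x-y]≈y x y = begin
    x + - (x + - y) ≈⟨ +-congˡ (⁻¹-anti-homo‿- x y) ⟩
    x + (y + - x)   ≈⟨ +-assoc x y (- x) ⟨
    x + y + - x     ≈⟨ xyx⁻¹≈y x y ⟩
    y               ∎

  x*[n×[y*z]]≈n×[x*y*z] : ∀ n x y z → x * (n × (y * z)) ≈ n × (x * y * z)
  x*[n×[y*z]]≈n×[x*y*z] n x y z = trans (×-comm-* n x (y * z)) (×-congʳ n (sym (*-assoc x y z)))

  sumTo-cong : ∀ n {f g : ℕ → Carrier} → (∀ k → k ≤ n → f k ≈ g k) →
               sumTo n f ≈ sumTo n g
  sumTo-cong zero    f≈g = f≈g 0 z≤n
  sumTo-cong (suc n) f≈g =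
    +-cong (sumTo-cong n (λ k k≤n → f≈g k (ℕₚ.m≤n⇒m≤1+n k≤n)))
           (f≈g (suc n) ℕₚ.≤-refl)

  sumTo-distrib-+ : ∀ n (f g : ℕ → Carrier) →
                    sumTo n (λ k → f k + g k) ≈ sumTo n f + sumTo n g
  sumTo-distrib-+ zero    f g = refl
  sumTo-distrib-+ (suc n) f g =
    trans (+-congʳ (sumTo-distrib-+ n f g)) (interchange (sumTo n f) (sumTo n g) _ _)

  *-distribˡ-sumTo : ∀ n x (f : ℕ → Carrier) → x * sumTo n f ≈ sumTo n (λ k → x * f k)
  *-distribˡ-sumTo zero    x f = refl
  *-distribˡ-sumTo (suc n) x f = trans (distribˡ x _ _) (+-congʳ (*-distribˡ-sumTo n x f))

  *-distribʳ-sumTo : ∀ n x (f : ℕ → Carrier) → sumTo n f * x ≈ sumTo n (λ k → f k * x)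
  *-distribʳ-sumTo zero    x f = refl
  *-distribʳ-sumTo (suc n) x f = trans (distribʳ x _ _) (+-congʳ (*-distribʳ-sumTo n x f))

  ×-distrib-sumTo : ∀ n m (f : ℕ → Carrier) → m × sumTo n f ≈ sumTo n (λ k → m × f k)
  ×-distrib-sumTo zero    m f = refl
  ×-distrib-sumTo (suc n) m f = trans (×-distrib-+ _ _ m) (+-congʳ (×-distrib-sumTo n m f))

  sumTo-uncons : ∀ n (g : ℕ → Carrier) → sumTo (suc n) g ≈ g 0 + sumTo n (g ∘ suc)
  sumTo-uncons zero    g = refl
  sumTo-uncons (suc n) g = trans (+-congʳ (sumTo-uncons n g)) (+-assoc _ _ _)

  sumTo-reverse : ∀ n (g : ℕ → Carrier) → sumTo n g ≈ sumTo n (λ k → g (n ∸ k))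
  sumTo-reverse zero    g = refl
  sumTo-reverse (suc n) g = begin
    sumTo n g + g (suc n)                 ≈⟨ +-comm _ _ ⟩
    g (suc n) + sumTo n g                 ≈⟨ +-congˡ (sumTo-reverse n g) ⟩
    g (suc n) + sumTo n (λ k → g (n ∸ k)) ≈⟨ sumTo-uncons n (λ k → g (suc n ∸ k)) ⟨
    sumTo (suc n) (λ k → g (suc n ∸ k))   ∎

  sum≈sumTo : ∀ n (g : ℕ → Carrier) → sum (λ (k : Fin (suc n)) → g (toℕ k)) ≈ sumTo n g
  sum≈sumTo zero    g = +-identityʳ (g 0)
  sum≈sumTo (suc n) g = trans (+-congˡ (sum≈sumTo n (g ∘ suc))) (sym (sumTo-uncons n g))

  sumTo-suc∸ : ∀ {j n} (g : ℕ → Carrier) → j ≤ n →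
               sumTo (suc n ∸ j) g ≈ sumTo (n ∸ j) g + g (suc n ∸ j)
  sumTo-suc∸ g j≤n rewrite ℕₚ.+-∸-assoc 1 j≤n = refl

  sumTo-n∸n : ∀ n (g : ℕ → Carrier) → sumTo (n ∸ n) g ≈ g (n ∸ n)
  sumTo-n∸n n g rewrite ℕₚ.n∸n≡0 n = refl

  sumTo-antidiagonal : ∀ n (h : ℕ → ℕ → Carrier) →
    sumTo n (λ j → sumTo (n ∸ j) (h j)) ≈ sumTo n (λ k → sumTo k (λ j → h j (k ∸ j)))
  sumTo-antidiagonal zero    h = refl
  sumTo-antidiagonal (suc n) h = begin
    sumTo n (λ j → sumTo (suc n ∸ j) (h j)) + sumTo (n ∸ n) (h (suc n))
      ≈⟨ +-cong (sumTo-cong n (λ j → sumTo-suc∸ (h j))) (sumTo-n∸n n (h (suc n))) ⟩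
    sumTo n (λ j → sumTo (n ∸ j) (h j) + h j (suc n ∸ j)) + h (suc n) (n ∸ n)
      ≈⟨ +-congʳ (sumTo-distrib-+ n _ _) ⟩
    sumTo n (λ j → sumTo (n ∸ j) (h j)) + sumTo n (λ j → h j (suc n ∸ j)) + h (suc n) (n ∸ n)
      ≈⟨ +-congʳ (+-congʳ (sumTo-antidiagonal n h)) ⟩
    sumTo n (λ k → sumTo k (λ j → h j (k ∸ j))) + sumTo n (λ j → h j (suc n ∸ j))
      + h (suc n) (n ∸ n)
      ≈⟨ +-assoc _ _ _ ⟩
    sumTo n (λ k → sumTo k (λ j → h j (k ∸ j))) + sumTo (suc n) (λ j → h j (suc n ∸ j)) ∎

  infixl 7 _⋆_
  _⋆_ : (ℕ → Carrier) → (ℕ → Carrier) → ℕ → Carrier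
  (u ⋆ v) n = sumTo n (λ k → (n C k) × (u k * v (n ∸ k)))

  infix 4 _≋_
  _≋_ : (ℕ → Carrier) → (ℕ → Carrier) → Set ℓ
  u ≋ v = ∀ n → u n ≈ v n

  powers : Carrier → ℕ → Carrier
  powers x n = x ^ n

  ⋆-cong : ∀ {u u′ v v′} → u ≋ u′ → v ≋ v′ → u ⋆ v ≋ u′ ⋆ v′
  ⋆-cong u≋u′ v≋v′ n =
    sumTo-cong n (λ k _ → ×-congʳ (n C k) (*-cong (u≋u′ k) (v≋v′ (n ∸ k))))

  ⋆-congˡ : ∀ {u u′} v → u ≋ u′ → u ⋆ v ≋ u′ ⋆ v
  ⋆-congˡ v u≋u′ = ⋆-cong {v = v} u≋u′ (λ _ → refl)

  ⋆-congʳ : ∀ u {v v′} → v ≋ v′ → u ⋆ v ≋ u ⋆ v′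
  ⋆-congʳ u v≋v′ = ⋆-cong {u = u} (λ _ → refl) v≋v′

  ⋆-comm : ∀ u v → u ⋆ v ≋ v ⋆ u
  ⋆-comm u v n = begin
    (u ⋆ v) n
      ≈⟨ sumTo-reverse n _ ⟩
    sumTo n (λ k → (n C (n ∸ k)) × (u (n ∸ k) * v (n ∸ (n ∸ k))))
      ≈⟨ sumTo-cong n reflect ⟩
    (v ⋆ u) n ∎
    where
    reflect : ∀ k → k ≤ n → (n C (n ∸ k)) × (u (n ∸ k) * v (n ∸ (n ∸ k))) ≈
                            (n C k) × (v k * u (n ∸ k))
    reflect k k≤n =
      ×-cong (≡.sym (nCk≡nC[n∸k] k≤n))
             (trans (*-comm _ _) (*-congʳ (reflexive (≡.cong v (ℕₚ.m∸[m∸n]≡n k≤n)))))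

  ⋆-assoc : ∀ u v w → (u ⋆ v) ⋆ w ≋ u ⋆ (v ⋆ w)
  ⋆-assoc u v w n = begin
    ((u ⋆ v) ⋆ w) n
      ≈⟨ sumTo-cong n (λ k _ → expandˡ k) ⟩
    sumTo n (λ k → sumTo k (λ j → ((n C k) ℕ.* (k C j)) × (u j * (v (k ∸ j) * w (n ∸ k)))))
      ≈⟨ sumTo-cong n (λ k k≤n → sumTo-cong k (λ j j≤k → regroup j≤k k≤n)) ⟨
    sumTo n (λ k → sumTo k (λ j → t j (k ∸ j)))
      ≈⟨ sumTo-antidiagonal n t ⟨
    sumTo n (λ j → sumTo (n ∸ j) (t j))
      ≈⟨ sumTo-cong n (λ j _ → expandʳ j) ⟨
    (u ⋆ (v ⋆ w)) n ∎
    where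
    t : ℕ → ℕ → Carrier
    t j i = ((n C j) ℕ.* ((n ∸ j) C i)) × (u j * (v i * w (n ∸ j ∸ i)))

    expandˡ : ∀ k → (n C k) × ((u ⋆ v) k * w (n ∸ k)) ≈
                    sumTo k (λ j → ((n C k) ℕ.* (k C j)) × (u j * (v (k ∸ j) * w (n ∸ k))))
    expandˡ k = begin
      (n C k) × ((u ⋆ v) k * w (n ∸ k))
        ≈⟨ ×-congʳ (n C k) (*-distribʳ-sumTo k _ _) ⟩
      (n C k) × sumTo k (λ j → (k C j) × (u j * v (k ∸ j)) * w (n ∸ k))
        ≈⟨ ×-distrib-sumTo k (n C k) _ ⟩
      sumTo k (λ j → (n C k) × ((k C j) × (u j * v (k ∸ j)) * w (n ∸ k)))
        ≈⟨ sumTo-cong k (λ j _ → ×-congʳ (n C k) (×-assoc-* (k C j) _ _)) ⟩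
      sumTo k (λ j → (n C k) × ((k C j) × (u j * v (k ∸ j) * w (n ∸ k))))
        ≈⟨ sumTo-cong k (λ j _ → trans (×-assocˡ _ (n C k) (k C j))
                                        (×-congʳ ((n C k) ℕ.* (k C j)) (*-assoc _ _ _))) ⟩
      sumTo k (λ j → ((n C k) ℕ.* (k C j)) × (u j * (v (k ∸ j) * w (n ∸ k)))) ∎

    expandʳ : ∀ j → (n C j) × (u j * (v ⋆ w) (n ∸ j)) ≈ sumTo (n ∸ j) (t j)
    expandʳ j = begin
      (n C j) × (u j * (v ⋆ w) (n ∸ j))
        ≈⟨ ×-congʳ (n C j) (*-distribˡ-sumTo (n ∸ j) (u j) _) ⟩
      (n C j) × sumTo (n ∸ j) (λ i → u j * (((n ∸ j) C i) × (v i * w (n ∸ j ∸ i))))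
        ≈⟨ ×-distrib-sumTo (n ∸ j) (n C j) _ ⟩
      sumTo (n ∸ j) (λ i → (n C j) × (u j * (((n ∸ j) C i) × (v i * w (n ∸ j ∸ i)))))
        ≈⟨ sumTo-cong (n ∸ j) (λ i _ → trans (×-congʳ (n C j) (×-comm-* ((n ∸ j) C i) _ _))
                                              (×-assocˡ _ (n C j) ((n ∸ j) C i))) ⟩
      sumTo (n ∸ j) (t j) ∎

    regroup : ∀ {j k} → j ≤ k → k ≤ n →
              t j (k ∸ j) ≈ ((n C k) ℕ.* (k C j)) × (u j * (v (k ∸ j) * w (n ∸ k)))
    regroup j≤k k≤n =
      ×-cong (nCj*[n∸j]C[k∸j]≡nCk*kCj j≤k k≤n)
             (*-congˡ (*-congˡ (reflexive (≡.cong w (n∸j∸[k∸j]≡n∸k n j≤k)))))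

  powers-+ : ∀ x y → powers (x + y) ≋ powers x ⋆ powers y
  powers-+ x y n =
    trans (Binomial.theorem n x y) (sum≈sumTo n (λ k → (n C k) × (x ^ k * y ^ (n ∸ k))))

  appell-shift : ∀ cs y z → (λ n → appell cs n (y + z)) ≋ (λ n → appell cs n y) ⋆ powers z
  appell-shift cs y z n = begin
    (cs ⋆ powers (y + z)) n          ≈⟨ ⋆-congʳ cs (powers-+ y z) n ⟩
    (cs ⋆ (powers y ⋆ powers z)) n   ≈⟨ ⋆-assoc cs (powers y) (powers z) n ⟨
    (cs ⋆ powers y ⋆ powers z) n     ∎

  ⋆-powers≈S : ∀ a q x →
               (λ j → a j * ((1# - q) * x) ^ j) ⋆ powers (q * x) ≋ (λ k → S a k q * x ^ k)
  ⋆-powers≈S a q x k = begin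
    sumTo k (λ j → (k C j) × (a j * (p * x) ^ j * (q * x) ^ (k ∸ j)))
      ≈⟨ sumTo-cong k term ⟩
    sumTo k (λ j → a j * ((k C j) × (p ^ j * q ^ (k ∸ j))) * x ^ k)
      ≈⟨ *-distribʳ-sumTo k (x ^ k) _ ⟨
    S a k q * x ^ k ∎
    where
    p : Carrier
    p = 1# - q

    term : ∀ j → j ≤ k → (k C j) × (a j * (p * x) ^ j * (q * x) ^ (k ∸ j)) ≈
                         a j * ((k C j) × (p ^ j * q ^ (k ∸ j))) * x ^ k
    term j j≤k = begin
      (k C j) × (a j * (p * x) ^ j * (q * x) ^ (k ∸ j))
        ≈⟨ ×-congʳ (k C j) (*-cong (*-congˡ (^-distrib-* p x j)) (^-distrib-* q x (k ∸ j))) ⟩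
      (k C j) × (a j * (p ^ j * x ^ j) * (q ^ (k ∸ j) * x ^ (k ∸ j)))
        ≈⟨ ×-congʳ (k C j) (solve 5 (λ A P X Q Y → A :* (P :* X) :* (Q :* Y)
                                                 := A :* (P :* Q) :* (X :* Y))
                                      refl (a j) (p ^ j) (x ^ j) (q ^ (k ∸ j)) (x ^ (k ∸ j))) ⟩
      (k C j) × (a j * (p ^ j * q ^ (k ∸ j)) * (x ^ j * x ^ (k ∸ j)))
        ≈⟨ ×-congʳ (k C j) (*-congˡ x^j*x^[k∸j]≈x^k) ⟩
      (k C j) × (a j * (p ^ j * q ^ (k ∸ j)) * x ^ k)
        ≈⟨ ×-assoc-* (k C j) _ _ ⟨
      (k C j) × (a j * (p ^ j * q ^ (k ∸ j))) * x ^ k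
        ≈⟨ *-congʳ (×-comm-* (k C j) (a j) _) ⟨
      a j * ((k C j) × (p ^ j * q ^ (k ∸ j))) * x ^ k ∎
      where
      x^j*x^[k∸j]≈x^k : x ^ j * x ^ (k ∸ j) ≈ x ^ k
      x^j*x^[k∸j]≈x^k = trans (sym (^-homo-* x j (k ∸ j))) (^-congʳ x (ℕₚ.m+[n∸m]≡n j≤k))

mainTheorem13 : {c ℓ : Level} (R : CommutativeRing c ℓ) →
    let open CommutativeRing R
        open Appell R
    in (cs : ℕ → Carrier) → cs 0 ≈ 1# → (a : ℕ → Carrier) →
       (b x y : Carrier) → (n : ℕ) →
       sumTo n (λ k → a k * ((n C k) × ((b * x) ^ k * appell cs (n ∸ k) (y + (1# - b) * x))))
         ≈ sumTo n (λ k → S a k (1# - b) * ((n C k) × (x ^ k * appell cs (n ∸ k) y)))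
mainTheorem13 R cs _ a b x y n = begin
    sumTo n (λ k → a k * ((n C k) × ((b * x) ^ k * appell cs (n ∸ k) (y + w * x))))
      ≈⟨ sumTo-cong n (λ k _ → x*[n×[y*z]]≈n×[x*y*z] (n C k) (a k) _ _) ⟩
    ((λ k → a k * (b * x) ^ k) ⋆ (λ m → appell cs m (y + w * x))) n
      ≈⟨ ⋆-cong (λ k → *-congˡ (^-congˡ k (*-congʳ (sym (x-[x-y]≈y 1# b)))))
                (appell-shift cs y (w * x)) n ⟩
    (α ⋆ (f ⋆ powers (w * x))) n
      ≈⟨ ⋆-congʳ α (⋆-comm f (powers (w * x))) n ⟩
    (α ⋆ (powers (w * x) ⋆ f)) n
      ≈⟨ ⋆-assoc α (powers (w * x)) f n ⟨
    (α ⋆ powers (w * x) ⋆ f) n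
      ≈⟨ ⋆-congˡ f (⋆-powers≈S a w x) n ⟩
    ((λ k → S a k w * x ^ k) ⋆ f) n
      ≈⟨ sumTo-cong n (λ k _ → x*[n×[y*z]]≈n×[x*y*z] (n C k) (S a k w) _ _) ⟨
    sumTo n (λ k → S a k w * ((n C k) × (x ^ k * appell cs (n ∸ k) y))) ∎
  where
  open CommutativeRing R
  open Appell R
  open BinomialConvolution R
  open import Relation.Binary.Reasoning.Setoid setoid
  open import Algebra.Properties.Semiring.Exp semiring using (^-congˡ)

  w : Carrier
  w = 1# - b

  f : ℕ → Carrier
  f m = appell cs m y

  α : ℕ → Carrier
  α j = a j * ((1# - w) * x) ^ j
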